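{- Let $\Gamma=(V,E)$ be a reduced graph. Then $\gamma(\mathrm{Aut}^{\pi}(\Gamma)) = \mathrm{Aut}^{\pi}(\Gamma)$ and $\gamma$ is a group automorphism of $\mathrm{Aut}^{\pi}(\Gamma)$. Furthermore $\gamma^2 = \mathrm{Id}$, the set of fixed points of $\gamma$ equals $\mathrm{Aut}(\Gamma)$, and for all $\pi\in\mathrm{Aut}^{\pi}(\Gamma)$ and all $v,w\in V$: $$(v,w)\in E \iff (\pi(v),\gamma(\pi)(w))\in E.$$
   Context: Graphs are finite, simple, loopless; $N(v)=\{w:(v,w)\in E\}$; $\Gamma$ is reduced if $N(v)=N(w)$ implies $v=w$. $\mathrm{Aut}^{\pi}(\Gamma)$ is the group of bijections $\pi:V\to V$ such that for every $v$ there exists $w$ with $\pi(N(v))=N(w)$. For $\pi\in\mathrm{Aut}^{\pi}(\Gamma)$, $\gamma(\pi)$ is the permutation of $V$ sending $v$ to the unique $w$ with $N(w)=\pi(N(v))$. -}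

module Defs where

open import Data.Nat using (ℕ)
open import Data.Fin using (Fin)
open import Data.Bool using (Bool; true)
open import Data.Product using (Σ; ∃; _×_; _,_; proj₁; proj₂)
open import Relation.Binary.PropositionalEquality using (_≡_; _≢_)
open import Function.Bundles using (_⇔_)
import Function.Definitions as FD

record Graph (n : ℕ) : Set where
  field
    E     : Fin n → Fin n → Bool
    sym   : ∀ v w → E v w ≡ E w v
    irrfl : ∀ v → E v v ≢ true

module _ {n : ℕ} (Γ : Graph n) where
  open Graph Γ

  Adj : Fin n → Fin n → Set
  Adj v w = E v w ≡ true

  VSet : Set₁
  VSet = Fin n → Set

  N : Fin n → VSet
  N v w = Adj v w

  Reduced : Set
  Reduced = ∀ v w → (∀ x → N v x ⇔ N w x) → v ≡ w

image : {n : ℕ} → (Fin n → Fin n) → (Fin n → Set) → (Fin n → Set)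
image f S x = ∃ λ u → S u × f u ≡ x

_≐_ : {n : ℕ} → (Fin n → Set) → (Fin n → Set) → Set
S ≐ T = ∀ x → S x ⇔ T x

Bijective : {n : ℕ} → (Fin n → Fin n) → Set
Bijective = FD.Bijective _≡_ _≡_

_≗_ : {n : ℕ} → (Fin n → Fin n) → (Fin n → Fin n) → Set
f ≗ g = ∀ x → f x ≡ g x

module _ {n : ℕ} (Γ : Graph n) where

  IsAutπ : (Fin n → Fin n) → Set
  IsAutπ π = Bijective π × (∀ v → ∃ λ w → image π (N Γ v) ≐ N Γ w)

  IsAut : (Fin n → Fin n) → Set
  IsAut π = Bijective π × (∀ v w → Adj Γ v w ⇔ Adj Γ (π v) (π w))

  -- γ(π)(v) = the (for reduced Γ unique) w with N(w) = π(N(v))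
  γ : (π : Fin n → Fin n) → IsAutπ π → Fin n → Fin n
  γ π p v = proj₁ (proj₂ p v)

-- Call a pair of maps (g , π) adjacency-preserving when v ~ u ⇔ g v ~ π u for all
-- vertices.  By definition of γ the pair (γ(π) , π) is adjacency-preserving, and by
-- symmetry of E so is (π , γ(π)).  In a reduced graph a vertex is determined by its
-- neighbourhood, so every such g is injective (hence bijective, V being finite), and
-- for surjective π the g with (g , π) adjacency-preserving is unique.  Uniqueness
-- applied to (π , γ(π)) gives γ² = Id, to composed pairs the homomorphism property,
-- and to (π , π) the fixed points.

module Submission where

open import Defs
open import Data.Nat using (ℕ; zero; suc)
open import Data.Nat.Properties using (1+n≰n)
open import Data.Fin using (Fin; punchOut)
open import Data.Fin.Properties using (_≟_; any?; punchOut-injective; injective⇒≤)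
open import Data.Product using (Σ; ∃; _×_; _,_; proj₁; proj₂)
open import Function.Base using (_∘_)
open import Function.Bundles using (_⇔_; mk⇔; Equivalence)
open import Function.Definitions using (Injective; StrictlySurjective)
open import Function.Consequences.Propositional
  using (strictlySurjective⇒surjective; surjective⇒strictlySurjective)
open import Function.Properties.Equivalence using () renaming (sym to ⇔-sym; trans to ⇔-trans)
open import Relation.Binary.PropositionalEquality using (_≡_; refl; sym; trans; subst)
open import Relation.Nullary using (yes; no; contradiction)

open Equivalence

injective⇒strictlySurjective : ∀ {n} {f : Fin n → Fin n} →
  Injective _≡_ _≡_ f → StrictlySurjective _≡_ f
injective⇒strictlySurjective {zero}      _     ()
injective⇒strictlySurjective {suc n} {f} f-inj y with any? (λ x → f x ≟ y)
... | yes hit  = hit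
... | no  miss = contradiction (injective⇒≤ g-inj) 1+n≰n
  where
  g : Fin (suc n) → Fin n
  g x = punchOut {i = y} {j = f x} (λ y≡fx → miss (x , sym y≡fx))

  g-inj : Injective _≡_ _≡_ g
  g-inj = f-inj ∘ punchOut-injective {i = y} _ _

module _ {n : ℕ} (Γ : Graph n) where

  private
    V : Set
    V = Fin n

    _~_ : V → V → Set
    _~_ = Adj Γ

  PreservesAdj : (V → V) → (V → V) → Set
  PreservesAdj g π = ∀ v u → v ~ u ⇔ g v ~ π u

  ~-comm : ∀ v u → v ~ u ⇔ u ~ v
  ~-comm v u = mk⇔ (trans (Graph.sym Γ u v)) (trans (Graph.sym Γ v u))

  PreservesAdj-flip : ∀ {g π} → PreservesAdj g π → PreservesAdj π g
  PreservesAdj-flip {g} {π} P v u =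
    ⇔-trans (~-comm v u) (⇔-trans (P u v) (~-comm (g u) (π v)))

  PreservesAdj-∘ : ∀ {g σ g′ π} → PreservesAdj g σ → PreservesAdj g′ π →
    PreservesAdj (g′ ∘ g) (π ∘ σ)
  PreservesAdj-∘ {g} {σ} P P′ v u = ⇔-trans (P v u) (P′ (g v) (σ u))

  PreservesAdj-congʳ : ∀ {g π π′} → π ≗ π′ → PreservesAdj g π → PreservesAdj g π′
  PreservesAdj-congʳ {g} e P v u = subst (λ z → v ~ u ⇔ g v ~ z) (e u) (P v u)

  image-N≐N : ∀ {g f} → StrictlySurjective _≡_ f → PreservesAdj g f →
    ∀ w → image f (N Γ w) ≐ N Γ (g w)
  image-N≐N {g} surj P w x = mk⇔
    (λ { (u , w~u , refl) → to (P w u) w~u })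
    (λ gw~x → let (u , fu≡x) = surj x in
      u , from (P w u) (subst (g w ~_) (sym fu≡x) gw~x) , fu≡x)

  γ-preservesAdj : ∀ π (p : IsAutπ Γ π) → PreservesAdj (γ Γ π p) π
  γ-preservesAdj π p w u = mk⇔
    (λ w~u → to (image≐N (π u)) (u , w~u , refl))
    (λ h → let (u′ , w~u′ , πu′≡πu) = from (image≐N (π u)) h in
      subst (w ~_) (proj₁ (proj₁ p) πu′≡πu) w~u′)
    where
    image≐N : image π (N Γ w) ≐ N Γ (γ Γ π p w)
    image≐N = proj₂ (proj₂ p w)

  isAut⇒isAutπ : ∀ π → IsAut Γ π → IsAutπ Γ π
  isAut⇒isAutπ π (π-bij , P) =
    π-bij , λ v → π v , image-N≐N (surjective⇒strictlySurjective (proj₂ π-bij)) P v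

  module _ (reduced : Reduced Γ) where

    preservesAdj⇒injective : ∀ {g π} → PreservesAdj g π → Injective _≡_ _≡_ g
    preservesAdj⇒injective {g} {π} P {w₁} {w₂} gw₁≡gw₂ = reduced w₁ w₂ λ x →
      ⇔-trans (subst (λ z → w₁ ~ x ⇔ z ~ π x) gw₁≡gw₂ (P w₁ x)) (⇔-sym (P w₂ x))

    preservesAdj-unique : ∀ {g g′ σ} → StrictlySurjective _≡_ σ →
      PreservesAdj g σ → PreservesAdj g′ σ → g ≗ g′
    preservesAdj-unique {g} {g′} {σ} surj P P′ v = reduced (g v) (g′ v) λ x →
      let (u , σu≡x) = surj x in
      subst (λ z → g v ~ z ⇔ g′ v ~ z) σu≡x (⇔-trans (⇔-sym (P v u)) (P′ v u))

    γ-unique : ∀ {g} σ (q : IsAutπ Γ σ) → PreservesAdj g σ → γ Γ σ q ≗ g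
    γ-unique σ q = preservesAdj-unique (surjective⇒strictlySurjective (proj₂ (proj₁ q)))
                                       (γ-preservesAdj σ q)

    γ-bijective : ∀ π (p : IsAutπ Γ π) → Bijective (γ Γ π p)
    γ-bijective π p = γ-inj , strictlySurjective⇒surjective (injective⇒strictlySurjective γ-inj)
      where
      γ-inj : Injective _≡_ _≡_ (γ Γ π p)
      γ-inj = preservesAdj⇒injective (γ-preservesAdj π p)

    γ-isAutπ : ∀ π (p : IsAutπ Γ π) → IsAutπ Γ (γ Γ π p)
    γ-isAutπ π p = γ-bijective π p , λ v → π v ,
      image-N≐N (surjective⇒strictlySurjective (proj₂ (γ-bijective π p)))
                (PreservesAdj-flip (γ-preservesAdj π p)) v

    γ-involutive : ∀ π (p : IsAutπ Γ π) (p′ : IsAutπ Γ (γ Γ π p)) → γ Γ (γ Γ π p) p′ ≗ π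
    γ-involutive π p p′ = γ-unique (γ Γ π p) p′ (PreservesAdj-flip (γ-preservesAdj π p))

    γ-homomorphism : ∀ π σ (p : IsAutπ Γ π) (q : IsAutπ Γ σ) (r : IsAutπ Γ (π ∘ σ)) →
      γ Γ (π ∘ σ) r ≗ (γ Γ π p ∘ γ Γ σ q)
    γ-homomorphism π σ p q r =
      γ-unique (π ∘ σ) r (PreservesAdj-∘ (γ-preservesAdj σ q) (γ-preservesAdj π p))

    γ-injective : ∀ π σ (p : IsAutπ Γ π) (q : IsAutπ Γ σ) → γ Γ π p ≗ γ Γ σ q → π ≗ σ
    γ-injective π σ p q γπ≗γσ x = trans (sym (γ-involutive π p p′ x)) (γ²π≗σ x)
      where
      p′ : IsAutπ Γ (γ Γ π p)
      p′ = γ-isAutπ π p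

      γ²π≗σ : γ Γ (γ Γ π p) p′ ≗ σ
      γ²π≗σ = γ-unique (γ Γ π p) p′
        (PreservesAdj-congʳ (sym ∘ γπ≗γσ) (PreservesAdj-flip (γ-preservesAdj σ q)))

    γ-fixed⇔isAut : ∀ π (p : IsAutπ Γ π) → γ Γ π p ≗ π ⇔ IsAut Γ π
    γ-fixed⇔isAut π p = mk⇔
      (λ γπ≗π → proj₁ p , PreservesAdj-congʳ γπ≗π (PreservesAdj-flip (γ-preservesAdj π p)))
      (λ { (_ , P) → γ-unique π p P })

theorem2p2 : {n : ℕ} (Γ : Graph n) → Reduced Γ →
    ((π : Fin n → Fin n) (p : IsAutπ Γ π) → IsAutπ Γ (γ Γ π p))
    × ((σ : Fin n → Fin n) → IsAutπ Γ σ →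
         ∃ λ π → Σ (IsAutπ Γ π) λ p → γ Γ π p ≗ σ)
    × ((π σ : Fin n → Fin n) (p : IsAutπ Γ π) (q : IsAutπ Γ σ) (r : IsAutπ Γ (π ∘ σ)) →
         γ Γ (π ∘ σ) r ≗ (γ Γ π p ∘ γ Γ σ q))
    × ((π σ : Fin n → Fin n) (p : IsAutπ Γ π) (q : IsAutπ Γ σ) →
         γ Γ π p ≗ γ Γ σ q → π ≗ σ)
    × ((π : Fin n → Fin n) (p : IsAutπ Γ π) (p' : IsAutπ Γ (γ Γ π p)) →
         γ Γ (γ Γ π p) p' ≗ π)
    × ((π : Fin n → Fin n) → IsAut Γ π → IsAutπ Γ π)
    × ((π : Fin n → Fin n) (p : IsAutπ Γ π) → (γ Γ π p ≗ π ⇔ IsAut Γ π))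
    × ((π : Fin n → Fin n) (p : IsAutπ Γ π) (v w : Fin n) →
         Adj Γ v w ⇔ Adj Γ (π v) (γ Γ π p w))
theorem2p2 Γ reduced =
    γ-isAutπ Γ reduced
  , (λ σ q → γ Γ σ q , γ-isAutπ Γ reduced σ q
                     , γ-involutive Γ reduced σ q (γ-isAutπ Γ reduced σ q))
  , γ-homomorphism Γ reduced
  , γ-injective Γ reduced
  , γ-involutive Γ reduced
  , isAut⇒isAutπ Γ
  , γ-fixed⇔isAut Γ reduced
  , λ π p → PreservesAdj-flip Γ (γ-preservesAdj Γ π p)
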